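{- Let $\mathcal{Q}$ be a seminormal quasi-crystal with underlying set $Q$, and let $w\in Q^*$. Then $w\ \ddot{\sim}\ w^2$ if and only if $w$ is an isolated element of $\mathcal{Q}^{*}$ and $\mathrm{wt}(w)=0$.
   Context: Root system data: $V$ a finite-dimensional real inner product space, $\alpha^\vee=\frac{2}{\langle\alpha,\alpha\rangle}\alpha$; a root system $\Phi$ with fixed simple roots $(\alpha_i)_{i\in I}$ and weight lattice $\Lambda$ (a $\mathbb{Z}$-submodule of $V$ spanning $V$, containing $\Phi$, with $\langle\lambda,\alpha^\vee\rangle\in\mathbb{Z}$ for $\alpha\in\Phi$). A quasi-crystal of type $\Phi$ is a set $Q$ with maps $\mathrm{wt}:Q\to\Lambda$, $\ddot{e}_i,\ddot{f}_i:Q\to Q\sqcup\{\bot\}$ ($\bot$ = undefined), $\ddot{\varepsilon}_i,\ddot{\varphi}_i:Q\to\mathbb{Z}\cup\{\pm\infty\}$ ($i\in I$) such that: $\ddot{\varphi}_i(x)=\ddot{\varepsilon}_i(x)+\langle\mathrm{wt}(x),\alpha_i^\vee\rangle$ (with $m+(\pm\infty)=\pm\infty$); if $\ddot{e}_i(x)\in Q$ then $\mathrm{wt}(\ddot{e}_i(x))=\mathrm{wt}(x)+\alpha_i$, $\ddot{\varepsilon}_i(\ddot{e}_i(x))=\ddot{\varepsilon}_i(x)-1$, $\ddot{\varphi}_i(\ddot{e}_i(x))=\ddot{\varphi}_i(x)+1$; if $\ddot{f}_i(x)\in Q$ then $\mathrm{wt}(\ddot{f}_i(x))=\mathrm{wt}(x)-\alpha_i$,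 $\ddot{\varepsilon}_i(\ddot{f}_i(x))=\ddot{\varepsilon}_i(x)+1$, $\ddot{\varphi}_i(\ddot{f}_i(x))=\ddot{\varphi}_i(x)-1$; $\ddot{e}_i(x)=y\iff x=\ddot{f}_i(y)$; $\ddot{\varepsilon}_i(x)=\pm\infty$ implies $\ddot{e}_i(x)=\ddot{f}_i(x)=\bot$. Seminormal: whenever $\ddot{\varepsilon}_i(x)\ne+\infty$, $\ddot{\varepsilon}_i(x)=\max\{k\ge0:\ddot{e}_i^k(x)\in Q\}$ and $\ddot{\varphi}_i(x)=\max\{k\ge0:\ddot{f}_i^k(x)\in Q\}$. A quasi-crystal isomorphism between quasi-crystals with underlying sets $X,Y$ is a bijection $\psi:X\to Y$ preserving $\mathrm{wt},\ddot{\varepsilon}_i,\ddot{\varphi}_i$ such that $\ddot{e}_i(\psi(x))$ is defined iff $\ddot{e}_i(x)$ is, and then $\psi(\ddot{e}_i(x))=\ddot{e}_i(\psi(x))$; likewise for $\ddot{f}_i$. The free quasi-crystal monoid $\mathcal{Q}^{*}$: words over $Q$ with: for the empty word, $\mathrm{wt}=0$, $\ddot{\varepsilon}_i=\ddot{\varphi}_i=0$, $\ddot{e}_i,\ddot{f}_i$ undefined; for $w=x_1\cdots x_m$ ($m\ge1$), $\mathrm{wt}(w)=\sum_k\mathrm{wt}(x_k)$, and with $p=\max\{k:\ddot{\varepsilon}_i(x_k)>0\}$, $q=\min\{l:\ddot{\varphi}_i(x_l)>0\}$: if some $\ddot{\varepsilon}_i(x_k)=+\infty$, or $p,q$ exist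 with $p>q$, then $\ddot{\varepsilon}_i(w)=\ddot{\varphi}_i(w)=+\infty$ and $\ddot{e}_i,\ddot{f}_i$ undefined on $w$; otherwise $\ddot{\varepsilon}_i(w)=\sum_k\ddot{\varepsilon}_i(x_k)$, $\ddot{\varphi}_i(w)=\sum_k\ddot{\varphi}_i(x_k)$, $\ddot{e}_i(w)$ is defined iff $p$ exists and is then $w$ with $x_p$ replaced by $\ddot{e}_i(x_p)$, and $\ddot{f}_i(w)$ is defined iff $q$ exists and is then $w$ with $x_q$ replaced by $\ddot{f}_i(x_q)$. The connected component $Q^*(w)$ is the set of words obtained from $w$ by finitely many (defined) applications of operators $\ddot{e}_i,\ddot{f}_i$, with restricted structure; $w$ is isolated if $Q^*(w)=\{w\}$. Hypoplactic congruence: $u\ddot{\sim}v$ iff there is a quasi-crystal isomorphism $Q^*(u)\to Q^*(v)$ sending $u$ to $v$. -}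

module Defs where

open import Data.Nat as ℕ using (ℕ; zero; suc; _≤_; _<ᵇ_)
open import Data.Integer as ℤ using (ℤ; +_; -[1+_])
open import Data.Fin using (Fin)
open import Data.Bool using (Bool; true; false; if_then_else_; _∨_)
open import Data.Maybe using (Maybe; just; nothing; _>>=_)
open import Data.Maybe as Maybe using ()
open import Data.List using (List; []; _∷_; foldr)
open import Data.Bool.ListAction using (any)
open import Data.Product using (Σ; _×_; _,_)
open import Data.Sum using (_⊎_)
open import Relation.Nullary using (¬_; does)
open import Relation.Binary.PropositionalEquality using (_≡_; _≢_)
open import Function.Bundles using (_⇔_)

-- The index set of simple roots is I = Fin rank.  The weight lattice Λ
-- is an abelian group (a ℤ-submodule of V, hence torsion-free), with
-- simple roots α i ∈ Λ and the ℤ-valued coroot pairings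
-- ⟨_, α i ^∨⟩ : Λ → ℤ, which are additive and satisfy ⟨α i, α i^∨⟩ = 2.

record RootDatum : Set₁ where
  field
    rank   : ℕ
    Λ      : Set
    _+Λ_   : Λ → Λ → Λ
    0Λ     : Λ
    -Λ_    : Λ → Λ
    +Λ-assoc   : ∀ x y z → (x +Λ y) +Λ z ≡ x +Λ (y +Λ z)
    +Λ-comm    : ∀ x y → x +Λ y ≡ y +Λ x
    +Λ-identityˡ : ∀ x → 0Λ +Λ x ≡ x
    +Λ-inverseˡ  : ∀ x → (-Λ x) +Λ x ≡ 0Λ
    _·Λ_   : ℕ → Λ → Λ
    ·Λ-zero : ∀ x → 0 ·Λ x ≡ 0Λ
    ·Λ-suc  : ∀ n x → suc n ·Λ x ≡ x +Λ (n ·Λ x)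
    torsion-free : ∀ n x → suc n ·Λ x ≡ 0Λ → x ≡ 0Λ
    α      : Fin rank → Λ
    pair   : Fin rank → Λ → ℤ
    pair-+ : ∀ i x y → pair i (x +Λ y) ≡ pair i x ℤ.+ pair i y
    pair-αα : ∀ i → pair i (α i) ≡ + 2

data ℤ∞ : Set where
  fin : ℤ → ℤ∞
  +∞  : ℤ∞
  -∞  : ℤ∞

infixl 6 _⊞_
_⊞_ : ℤ∞ → ℤ → ℤ∞
fin m ⊞ n = fin (m ℤ.+ n)
+∞ ⊞ n = +∞
-∞ ⊞ n = -∞

-- sum in ℤ∞ (the mixed case +∞ ⊕ -∞ never arises in the word rules)
infixr 6 _⊕_
_⊕_ : ℤ∞ → ℤ∞ → ℤ∞
+∞ ⊕ _ = +∞
_ ⊕ +∞ = +∞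
fin a ⊕ fin b = fin (a ℤ.+ b)
fin _ ⊕ -∞ = -∞
-∞ ⊕ _ = -∞

isPos : ℤ∞ → Bool
isPos (fin z) = does (+ 0 ℤ.<? z)
isPos +∞ = true
isPos -∞ = false

isPlusInf : ℤ∞ → Bool
isPlusInf +∞ = true
isPlusInf _ = false

iterM : {A : Set} → (A → Maybe A) → ℕ → A → Maybe A
iterM g zero x = just x
iterM g (suc k) x = iterM g k x >>= g

IsMaxDefined : {A : Set} → (A → Maybe A) → A → ℕ → Set
IsMaxDefined g x k =
  (iterM g k x ≢ nothing) × (∀ m → iterM g m x ≢ nothing → m ≤ k)

record QuasiCrystal (R : RootDatum) : Set₁ where
  open RootDatum R
  field
    Q   : Set
    wt  : Q → Λ
    e f : Fin rank → Q → Maybe Q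
    ε φ : Fin rank → Q → ℤ∞
    φ-def : ∀ i x → φ i x ≡ ε i x ⊞ pair i (wt x)
    e-wt  : ∀ i x y → e i x ≡ just y → wt y ≡ wt x +Λ α i
    e-ε   : ∀ i x y → e i x ≡ just y → ε i y ≡ ε i x ⊞ -[1+ 0 ]
    e-φ   : ∀ i x y → e i x ≡ just y → φ i y ≡ φ i x ⊞ + 1
    f-wt  : ∀ i x y → f i x ≡ just y → wt y +Λ α i ≡ wt x
    f-ε   : ∀ i x y → f i x ≡ just y → ε i y ≡ ε i x ⊞ + 1
    f-φ   : ∀ i x y → f i x ≡ just y → φ i y ≡ φ i x ⊞ -[1+ 0 ]
    e⇔f   : ∀ i x y → (e i x ≡ just y) ⇔ (f i y ≡ just x)
    ∞-undef : ∀ i x → (ε i x ≡ +∞ ⊎ ε i x ≡ -∞) →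
              (e i x ≡ nothing) × (f i x ≡ nothing)

Seminormal : {R : RootDatum} → QuasiCrystal R → Set
Seminormal C = ∀ i x → ε i x ≢ +∞ →
    Σ ℕ (λ k → ε i x ≡ fin (+ k) × IsMaxDefined (e i) x k)
  × Σ ℕ (λ k → φ i x ≡ fin (+ k) × IsMaxDefined (f i) x k)
  where open QuasiCrystal C

lastIdx : {A : Set} → (A → Bool) → List A → Maybe ℕ
lastIdx P [] = nothing
lastIdx P (x ∷ xs) with lastIdx P xs
... | just k = just (suc k)
... | nothing = if P x then just 0 else nothing

firstIdx : {A : Set} → (A → Bool) → List A → Maybe ℕ
firstIdx P [] = nothing
firstIdx P (x ∷ xs) = if P x then just 0 else Maybe.map suc (firstIdx P xs)

updateAt : {A : Set} → ℕ → (A → Maybe A) → List A → Maybe (List A)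
updateAt _ g [] = nothing
updateAt zero g (x ∷ xs) = Maybe.map (_∷ xs) (g x)
updateAt (suc k) g (x ∷ xs) = Maybe.map (x ∷_) (updateAt k g xs)

pAfterQ : Maybe ℕ → Maybe ℕ → Bool
pAfterQ (just p) (just q) = q <ᵇ p
pAfterQ _ _ = false

module WordOps {R : RootDatum} (C : QuasiCrystal R) where
  open RootDatum R
  open QuasiCrystal C

  Word : Set
  Word = List Q

  wtW : Word → Λ
  wtW = foldr (λ x acc → wt x +Λ acc) 0Λ

  pIdx qIdx : Fin rank → Word → Maybe ℕ
  pIdx i = lastIdx (λ x → isPos (ε i x))
  qIdx i = firstIdx (λ x → isPos (φ i x))

  infCase : Fin rank → Word → Bool
  infCase i w = any (λ x → isPlusInf (ε i x)) w ∨ pAfterQ (pIdx i w) (qIdx i w)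

  εW φW : Fin rank → Word → ℤ∞
  εW i w = if infCase i w then +∞ else foldr (λ x acc → ε i x ⊕ acc) (fin (+ 0)) w
  φW i w = if infCase i w then +∞ else foldr (λ x acc → φ i x ⊕ acc) (fin (+ 0)) w

  eW fW : Fin rank → Word → Maybe Word
  eW i w = if infCase i w then nothing else (pIdx i w >>= λ p → updateAt p (e i) w)
  fW i w = if infCase i w then nothing else (qIdx i w >>= λ q → updateAt q (f i) w)

  -- v ∈ Q*(u): reachable from u by finitely many defined ë_i, f̈_i
  data Reach (u : Word) : Word → Set where
    here  : Reach u u
    stepE : ∀ {v v'} i → Reach u v → eW i v ≡ just v' → Reach u v'
    stepF : ∀ {v v'} i → Reach u v → fW i v ≡ just v' → Reach u v'

  Isolated : Word → Set
  Isolated w = ∀ v → Reach w v → v ≡ w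

  -- quasi-crystal isomorphism Q*(u) → Q*(v) sending u to v
  -- (ψ is given on words; only its restriction to Q*(u) matters)
  record CompIso (u v : Word) : Set where
    field
      ψ χ    : Word → Word
      ψ-into : ∀ x → Reach u x → Reach v (ψ x)
      χ-into : ∀ y → Reach v y → Reach u (χ y)
      χψ     : ∀ x → Reach u x → χ (ψ x) ≡ x
      ψχ     : ∀ y → Reach v y → ψ (χ y) ≡ y
      ψ-wt   : ∀ x → Reach u x → wtW (ψ x) ≡ wtW x
      ψ-ε    : ∀ i x → Reach u x → εW i (ψ x) ≡ εW i x
      ψ-φ    : ∀ i x → Reach u x → φW i (ψ x) ≡ φW i x
      ψ-e-just    : ∀ i x y → Reach u x → eW i x ≡ just y → eW i (ψ x) ≡ just (ψ y)
      ψ-e-nothing : ∀ i x → Reach u x → eW i x ≡ nothing → eW i (ψ x) ≡ nothing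
      ψ-f-just    : ∀ i x y → Reach u x → fW i x ≡ just y → fW i (ψ x) ≡ just (ψ y)
      ψ-f-nothing : ∀ i x → Reach u x → fW i x ≡ nothing → fW i (ψ x) ≡ nothing
      ψ-base : ψ u ≡ v

  Hypoplactic : Word → Word → Set
  Hypoplactic u v = CompIso u v

-- Call w stuck in direction i when either the word rule already makes ε̈ᵢ(w) = +∞, or every
-- letter of w has ε̈ᵢ = φ̈ᵢ = 0.  For a seminormal quasi-crystal this says exactly that ëᵢ and f̈ᵢ
-- are undefined on w, and it is visibly inherited by w².  Hence if w is isolated of weight 0,
-- then w² is isolated with the same weight, ε̈ᵢ and φ̈ᵢ, and w ↦ w² is an isomorphism of the two
-- one-point components.  Conversely an isomorphism Q*(w) → Q*(w²) gives wt w = 2 wt w, so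
-- wt w = 0, and ε̈ᵢ(w) = ε̈ᵢ(w²), φ̈ᵢ(w) = φ̈ᵢ(w²).  If ε̈ᵢ(w) is finite, so is ε̈ᵢ(w²), and both
-- are sums over the letters; the sums for w² being twice those for w, they vanish, so w is stuck.

module Submission where

open import Defs
open import Data.Bool using (Bool; true; false; if_then_else_; _∨_)
open import Data.Bool.ListAction using (any)
open import Data.Bool.Properties using (T-≡; ∨-zeroʳ; ∨-conicalˡ)
open import Data.Empty using (⊥-elim)
open import Data.Fin using (Fin)
open import Data.Integer using (+_; -[1+_])
import Data.Integer.Properties as ℤ
open import Algebra.Bundles using (AbelianGroup)
open import Algebra.Properties.Group (AbelianGroup.group ℤ.+-0-abelianGroup)
  using (identityʳ-unique)
open import Data.List using (List; []; _∷_; _++_; length; foldr; map)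
open import Data.List.Properties using (map-++)
open import Data.List.Relation.Unary.All as All using (All; []; _∷_)
open import Data.List.Relation.Unary.All.Properties using (++⁺)
open import Data.List.Relation.Unary.Any.Properties using (any⁺; any⁻; ++⁺ˡ)
open import Data.Maybe using (Maybe; just; nothing; _>>=_)
import Data.Maybe as Maybe
open import Data.Nat as ℕ using (ℕ; zero; suc; _<_; z<s; s<s)
import Data.Nat.Properties as ℕ
open import Data.Nat.ListAction using (sum)
open import Data.Nat.ListAction.Properties using (sum-++)
open import Data.Product using (Σ; _×_; _,_; proj₁; proj₂; uncurry)
open import Data.Sum using (_⊎_; inj₁; inj₂)
open import Function using (_∘_)
open import Function.Bundles using (_⇔_; mk⇔; Equivalence)
open import Relation.Binary.PropositionalEquality

if-true : ∀ {A : Set} {b} {x y : A} → b ≡ true → (if b then x else y) ≡ x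
if-true refl = refl

if-false : ∀ {A : Set} {b} {x y : A} → b ≡ false → (if b then x else y) ≡ y
if-false refl = refl

map-nothing⁻ : ∀ {A B : Set} {f : A → B} {m : Maybe A} → Maybe.map f m ≡ nothing → m ≡ nothing
map-nothing⁻ {m = nothing} _ = refl

if-bind≡just : ∀ {A B : Set} b (m : Maybe A) {k : A → Maybe B} {v} →
               (if b then nothing else (m >>= k)) ≡ just v →
               Σ A λ a → m ≡ just a × k a ≡ just v
if-bind≡just false (just a) eq = a , refl , eq

module _ {A : Set} (P : A → Bool) where

  any≡false⇒All : ∀ w → any P w ≡ false → All (λ x → P x ≡ false) w
  any≡false⇒All [] _ = []
  any≡false⇒All (x ∷ xs) h with P x in px
  ... | false = px ∷ any≡false⇒All xs h

  All⇒any≡false : ∀ {w} → All (λ x → P x ≡ false) w → any P w ≡ false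
  All⇒any≡false [] = refl
  All⇒any≡false (px ∷ pxs) = cong₂ _∨_ px (All⇒any≡false pxs)

  any-++ˡ : ∀ u {v} → any P u ≡ true → any P (u ++ v) ≡ true
  any-++ˡ u h = Equivalence.to T-≡ (any⁺ P (++⁺ˡ (any⁻ P u (Equivalence.from T-≡ h))))

  lastIdx-++ : ∀ u {v p} → lastIdx P v ≡ just p → lastIdx P (u ++ v) ≡ just (length u ℕ.+ p)
  lastIdx-++ [] h = h
  lastIdx-++ (x ∷ u) {v} h with lastIdx P (u ++ v) | lastIdx-++ u {v} h
  ... | _ | refl = refl

  lastIdx≡nothing⇒All : ∀ w → lastIdx P w ≡ nothing → All (λ x → P x ≡ false) w
  lastIdx≡nothing⇒All [] _ = []
  lastIdx≡nothing⇒All (x ∷ xs) h with lastIdx P xs in rest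
  ... | nothing with P x in px
  ...   | false = px ∷ lastIdx≡nothing⇒All xs rest

  All⇒lastIdx≡nothing : ∀ {w} → All (λ x → P x ≡ false) w → lastIdx P w ≡ nothing
  All⇒lastIdx≡nothing [] = refl
  All⇒lastIdx≡nothing {x ∷ xs} (px ∷ pxs) with lastIdx P xs | All⇒lastIdx≡nothing pxs
  ... | _ | refl rewrite px = refl

  update-last≢nothing : ∀ {g : A → Maybe A} w {p} → All (λ x → P x ≡ true → g x ≢ nothing) w →
                     lastIdx P w ≡ just p → updateAt p g w ≢ nothing
  update-last≢nothing (x ∷ xs) (gx ∷ gxs) h with lastIdx P xs in rest
  update-last≢nothing (x ∷ xs) (gx ∷ gxs) refl | just k = update-last≢nothing xs gxs rest ∘ map-nothing⁻
  ... | nothing with P x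
  update-last≢nothing (x ∷ xs) (gx ∷ gxs) refl | nothing | true = gx refl ∘ map-nothing⁻

  update-last≡nothing⇒All : ∀ {g : A → Maybe A} w → All (λ x → P x ≡ true → g x ≢ nothing) w →
                               (lastIdx P w >>= λ p → updateAt p g w) ≡ nothing → All (λ x → P x ≡ false) w
  update-last≡nothing⇒All w defined undefined with lastIdx P w in last
  ... | nothing = lastIdx≡nothing⇒All w last
  ... | just p = ⊥-elim (update-last≢nothing w defined last undefined)

  firstIdx-++ : ∀ u {v q} → firstIdx P u ≡ just q → firstIdx P (u ++ v) ≡ just q
  firstIdx-++ (x ∷ u) {v} h with P x
  ... | true = h
  ... | false with firstIdx P u in first
  firstIdx-++ (x ∷ u) {v} refl | false | just q rewrite firstIdx-++ u {v} first = refl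

  firstIdx<length : ∀ u {q} → firstIdx P u ≡ just q → q < length u
  firstIdx<length (x ∷ u) h with P x
  firstIdx<length (x ∷ u) refl | true = z<s
  ... | false with firstIdx P u in first
  firstIdx<length (x ∷ u) refl | false | just q = s<s (firstIdx<length u first)

  firstIdx≡nothing⇒All : ∀ w → firstIdx P w ≡ nothing → All (λ x → P x ≡ false) w
  firstIdx≡nothing⇒All [] _ = []
  firstIdx≡nothing⇒All (x ∷ xs) h with P x in px | firstIdx P xs in rest
  ... | false | nothing = px ∷ firstIdx≡nothing⇒All xs rest

  All⇒firstIdx≡nothing : ∀ {w} → All (λ x → P x ≡ false) w → firstIdx P w ≡ nothing
  All⇒firstIdx≡nothing [] = refl
  All⇒firstIdx≡nothing (px ∷ pxs) rewrite px | All⇒firstIdx≡nothing pxs = refl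

  update-first≢nothing : ∀ {g : A → Maybe A} w {q} → All (λ x → P x ≡ true → g x ≢ nothing) w →
                      firstIdx P w ≡ just q → updateAt q g w ≢ nothing
  update-first≢nothing (x ∷ xs) (gx ∷ gxs) h with P x
  update-first≢nothing (x ∷ xs) (gx ∷ gxs) refl | true = gx refl ∘ map-nothing⁻
  ... | false with firstIdx P xs in rest
  update-first≢nothing (x ∷ xs) (gx ∷ gxs) refl | false | just q =
    update-first≢nothing xs gxs rest ∘ map-nothing⁻

  update-first≡nothing⇒All : ∀ {g : A → Maybe A} w → All (λ x → P x ≡ true → g x ≢ nothing) w →
                                (firstIdx P w >>= λ q → updateAt q g w) ≡ nothing → All (λ x → P x ≡ false) w
  update-first≡nothing⇒All w defined undefined with firstIdx P w in first
  ... | nothing = firstIdx≡nothing⇒All w first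
  ... | just q = ⊥-elim (update-first≢nothing w defined first undefined)

fin-injective : ∀ {a b} → fin a ≡ fin b → a ≡ b
fin-injective refl = refl

isPlusInf≡false⇒≢+∞ : ∀ {t} → isPlusInf t ≡ false → t ≢ +∞
isPlusInf≡false⇒≢+∞ () refl

-- Junk value 0 outside the nonnegative finite values; only applied to values known to lie there.
natPart : ℤ∞ → ℕ
natPart (fin (+ k)) = k
natPart _ = 0

natPart-nonpositive : ∀ t → isPos t ≡ false → natPart t ≡ 0
natPart-nonpositive (fin (+ zero)) _ = refl
natPart-nonpositive (fin -[1+ _ ]) _ = refl
natPart-nonpositive -∞ _ = refl

fin-natPart-zero : ∀ {t} → t ≡ fin (+ natPart t) → natPart t ≡ 0 → t ≡ fin (+ 0)
fin-natPart-zero t≡ zero≡ = trans t≡ (cong (λ n → fin (+ n)) zero≡)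

foldr-⊕-natPart : ∀ {A : Set} (g : A → ℤ∞) {w} → All (λ x → g x ≡ fin (+ natPart (g x))) w →
                  foldr (λ x acc → g x ⊕ acc) (fin (+ 0)) w ≡ fin (+ sum (map (natPart ∘ g) w))
foldr-⊕-natPart g [] = refl
foldr-⊕-natPart g (gx ∷ gxs) = cong₂ _⊕_ gx (foldr-⊕-natPart g gxs)

foldr-⊕-zero : ∀ {A : Set} (g : A → ℤ∞) {w} → All (λ x → g x ≡ fin (+ 0)) w →
               foldr (λ x acc → g x ⊕ acc) (fin (+ 0)) w ≡ fin (+ 0)
foldr-⊕-zero g [] = refl
foldr-⊕-zero g (gx ∷ gxs) = cong₂ _⊕_ gx (foldr-⊕-zero g gxs)

sum≡0⇒All : ∀ {A : Set} (h : A → ℕ) w → sum (map h w) ≡ 0 → All (λ x → h x ≡ 0) w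
sum≡0⇒All h [] _ = []
sum≡0⇒All h (x ∷ xs) s≡0 = ℕ.m+n≡0⇒m≡0 (h x) s≡0 ∷ sum≡0⇒All h xs (ℕ.m+n≡0⇒n≡0 (h x) s≡0)

sum-++-self≡⇒0 : ∀ {A : Set} (h : A → ℕ) w → sum (map h (w ++ w)) ≡ sum (map h w) → sum (map h w) ≡ 0
sum-++-self≡⇒0 h w eq = ℕ.+-cancelˡ-≡ s s 0 (begin
    s ℕ.+ s                   ≡⟨ sum-++ (map h w) (map h w) ⟨
    sum (map h w ++ map h w)  ≡⟨ cong sum (map-++ h w w) ⟨
    sum (map h (w ++ w))      ≡⟨ eq ⟩
    s                         ≡⟨ ℕ.+-identityʳ s ⟨
    s ℕ.+ 0                   ∎)
  where
  open ≡-Reasoning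
  s = sum (map h w)

iterM-nothing : ∀ {A : Set} {g : A → Maybe A} {x} → g x ≡ nothing → ∀ k → iterM g (suc k) x ≡ nothing
iterM-nothing gx zero = gx
iterM-nothing {g = g} gx (suc k) = cong (_>>= g) (iterM-nothing gx k)

-- Seminormal C unfolds to  ε i x ≢ +∞ → CountsIterates (e i) x (ε i x) × CountsIterates (f i) x (φ i x).
CountsIterates : ∀ {A : Set} → (A → Maybe A) → A → ℤ∞ → Set
CountsIterates g x t = Σ ℕ λ k → t ≡ fin (+ k) × IsMaxDefined g x k

CountsIterates⇒finite : ∀ {A : Set} {g : A → Maybe A} {x t} → CountsIterates g x t → t ≡ fin (+ natPart t)
CountsIterates⇒finite (_ , refl , _) = refl

CountsIterates⇒defined : ∀ {A : Set} {g : A → Maybe A} {x t} → CountsIterates g x t →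
                         isPos t ≡ true → g x ≢ nothing
CountsIterates⇒defined (suc k , _ , defined , _) _ gx = defined (iterM-nothing gx k)
CountsIterates⇒defined (zero , refl , _) ()

updateAt-irreflexive : ∀ {A : Set} {g : A → Maybe A} → (∀ x → g x ≢ just x) →
                       ∀ p w → updateAt p g w ≢ just w
updateAt-irreflexive {g = g} irr zero (x ∷ xs) eq with g x in gx
updateAt-irreflexive irr zero (x ∷ xs) refl | just .x = irr x gx
updateAt-irreflexive {g = g} irr (suc p) (x ∷ xs) eq with updateAt p g xs in up
updateAt-irreflexive irr (suc p) (x ∷ xs) refl | just .xs = updateAt-irreflexive irr p xs up

undefined-if-only-self : ∀ {A : Set} {m : Maybe A} {a} → (∀ {v} → m ≡ just v → v ≡ a) → m ≢ just a →
                         m ≡ nothing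
undefined-if-only-self {m = nothing} _ _ = refl
undefined-if-only-self {m = just v} only-self not-self = ⊥-elim (not-self (cong just (only-self refl)))

module Doubling {R : RootDatum} (C : QuasiCrystal R) where
  open RootDatum R
  open QuasiCrystal C
  open WordOps C

  -- ε̈ᵢ drops by one along ëᵢ, which only an infinite ε̈ᵢ survives, and there ëᵢ is undefined.
  e-irreflexive : ∀ i x → e i x ≢ just x
  e-irreflexive i x ex with ε i x in εx | e-ε i x x ex
  ... | fin z | fixed with () ← identityʳ-unique z -[1+ 0 ] (sym (fin-injective fixed))
  ... | +∞ | _ with () ← trans (sym ex) (proj₁ (∞-undef i x (inj₁ εx)))
  ... | -∞ | _ with () ← trans (sym ex) (proj₁ (∞-undef i x (inj₂ εx)))

  f-irreflexive : ∀ i x → f i x ≢ just x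
  f-irreflexive i x = e-irreflexive i x ∘ Equivalence.from (e⇔f i x x)

  eW-irreflexive : ∀ i w → eW i w ≢ just w
  eW-irreflexive i w eq with if-bind≡just (infCase i w) (pIdx i w) eq
  ... | p , _ , moved = updateAt-irreflexive (e-irreflexive i) p w moved

  fW-irreflexive : ∀ i w → fW i w ≢ just w
  fW-irreflexive i w eq with if-bind≡just (infCase i w) (qIdx i w) eq
  ... | q , _ , moved = updateAt-irreflexive (f-irreflexive i) q w moved

  Inert : Fin rank → Word → Set
  Inert i w = eW i w ≡ nothing × fW i w ≡ nothing

  isolated⇒inert : ∀ {w} → Isolated w → ∀ i → Inert i w
  isolated⇒inert {w} iso i =
      undefined-if-only-self (λ {v} eq → iso v (stepE i here eq)) (eW-irreflexive i w)
    , undefined-if-only-self (λ {v} eq → iso v (stepF i here eq)) (fW-irreflexive i w)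

  inert⇒isolated : ∀ {w} → (∀ i → Inert i w) → Isolated w
  inert⇒isolated inert v here = refl
  inert⇒isolated inert v (stepE i r eq) with refl ← inert⇒isolated inert _ r
    with () ← trans (sym eq) (proj₁ (inert i))
  inert⇒isolated inert v (stepF i r eq) with refl ← inert⇒isolated inert _ r
    with () ← trans (sym eq) (proj₂ (inert i))

  wtW-++ : ∀ u v → wtW (u ++ v) ≡ wtW u +Λ wtW v
  wtW-++ [] v = sym (+Λ-identityˡ (wtW v))
  wtW-++ (x ∷ u) v = trans (cong (wt x +Λ_) (wtW-++ u v)) (sym (+Λ-assoc (wt x) (wtW u) (wtW v)))

  +Λ-idem⇒0 : ∀ a → a +Λ a ≡ a → a ≡ 0Λ
  +Λ-idem⇒0 a idem = begin
    a                  ≡⟨ +Λ-identityˡ a ⟨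
    0Λ +Λ a            ≡⟨ cong (_+Λ a) (+Λ-inverseˡ a) ⟨
    ((-Λ a) +Λ a) +Λ a ≡⟨ +Λ-assoc (-Λ a) a a ⟩
    (-Λ a) +Λ (a +Λ a) ≡⟨ cong ((-Λ a) +Λ_) idem ⟩
    (-Λ a) +Λ a        ≡⟨ +Λ-inverseˡ a ⟩
    0Λ                 ∎
    where open ≡-Reasoning

  Null : Fin rank → Q → Set
  Null i x = ε i x ≡ fin (+ 0) × φ i x ≡ fin (+ 0)

  Stuck : Fin rank → Word → Set
  Stuck i w = infCase i w ≡ true ⊎ All (Null i) w

  All-null⇒infCase≡false : ∀ {i w} → All (Null i) w → infCase i w ≡ false
  All-null⇒infCase≡false {i} {w} null = cong₂ _∨_
    (All⇒any≡false _ (All.map (cong isPlusInf ∘ proj₁) null))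
    (cong (λ m → pAfterQ m (qIdx i w)) (All⇒lastIdx≡nothing _ (All.map (cong isPos ∘ proj₁) null)))

  All-null⇒inert : ∀ {i w} → All (Null i) w → Inert i w
  All-null⇒inert {i} {w} null rewrite All-null⇒infCase≡false null
    | All⇒lastIdx≡nothing _ (All.map (cong isPos ∘ proj₁) null)
    | All⇒firstIdx≡nothing _ (All.map (cong isPos ∘ proj₂) null) = refl , refl

  stuck⇒inert : ∀ {i w} → Stuck i w → Inert i w
  stuck⇒inert (inj₁ inf) = if-true inf , if-true inf
  stuck⇒inert (inj₂ null) = All-null⇒inert null

  pAfterQ-++ : ∀ {i} u {v p q} → qIdx i u ≡ just q → pIdx i v ≡ just p →
               pAfterQ (pIdx i (u ++ v)) (qIdx i (u ++ v)) ≡ true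
  pAfterQ-++ u {p = p} qu pv = trans (cong₂ pAfterQ (lastIdx-++ _ u pv) (firstIdx-++ _ u qu))
    (Equivalence.to T-≡ (ℕ.<⇒<ᵇ (ℕ.<-≤-trans (firstIdx<length _ u qu) (ℕ.m≤m+n (length u) p))))

  infCase-++-self : ∀ i w → infCase i w ≡ true → infCase i (w ++ w) ≡ true
  infCase-++-self i w inf with any (λ x → isPlusInf (ε i x)) w in anyInf
  ... | true rewrite any-++ˡ _ w {w} anyInf = refl
  ... | false with pIdx i w in pw | qIdx i w in qw
  ...   | just p | just q =
    trans (cong (anyInf-ww ∨_) (pAfterQ-++ {i} w qw pw)) (∨-zeroʳ anyInf-ww)
    where anyInf-ww = any (λ x → isPlusInf (ε i x)) (w ++ w)

  stuck-++-self : ∀ {i w} → Stuck i w → Stuck i (w ++ w)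
  stuck-++-self {i} {w} (inj₁ inf) = inj₁ (infCase-++-self i w inf)
  stuck-++-self (inj₂ null) = inj₂ (++⁺ null null)

  -- εW i and φW i are total (ε i) i and total (φ i) i by definition.
  total : (Q → ℤ∞) → Fin rank → Word → ℤ∞
  total g i w = if infCase i w then +∞ else foldr (λ x acc → g x ⊕ acc) (fin (+ 0)) w

  stuck⇒total-++-self : ∀ {i w} (g : Q → ℤ∞) → (∀ {x} → Null i x → g x ≡ fin (+ 0)) → Stuck i w →
                        total g i (w ++ w) ≡ total g i w
  stuck⇒total-++-self {i} {w} g _ (inj₁ inf) =
    trans (if-true (infCase-++-self i w inf)) (sym (if-true inf))
  stuck⇒total-++-self {i} {w} g null⇒0 (inj₂ null) = begin
    total g i (w ++ w)                            ≡⟨ if-false (All-null⇒infCase≡false (++⁺ null null)) ⟩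
    foldr (λ x acc → g x ⊕ acc) (fin (+ 0)) (w ++ w) ≡⟨ foldr-⊕-zero g (All.map null⇒0 (++⁺ null null)) ⟩
    fin (+ 0)                                     ≡⟨ foldr-⊕-zero g (All.map null⇒0 null) ⟨
    foldr (λ x acc → g x ⊕ acc) (fin (+ 0)) w     ≡⟨ if-false (All-null⇒infCase≡false null) ⟨
    total g i w                                   ∎
    where open ≡-Reasoning

  stuck⇒square-hypoplactic : ∀ {w} → (∀ i → Stuck i w) → wtW w ≡ 0Λ → Hypoplactic w (w ++ w)
  stuck⇒square-hypoplactic {w} stuck wt≡0 = record
    { ψ = λ _ → w ++ w
    ; χ = λ _ → w
    ; ψ-into = λ _ _ → here
    ; χ-into = λ _ _ → here
    ; χψ = λ x r → sym (isolated-w x r)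
    ; ψχ = λ y r → sym (isolated-ww y r)
    ; ψ-wt = onComponent (λ x → wtW (w ++ w) ≡ wtW x) wt-ww
    ; ψ-ε = λ i → onComponent (λ x → εW i (w ++ w) ≡ εW i x) (stuck⇒total-++-self (ε i) proj₁ (stuck i))
    ; ψ-φ = λ i → onComponent (λ x → φW i (w ++ w) ≡ φW i x) (stuck⇒total-++-self (φ i) proj₂ (stuck i))
    ; ψ-e-just = λ i x y r ex →
        ⊥-elim (just≢nothing (trans (sym ex) (onComponent (λ x → eW i x ≡ nothing) (proj₁ (inert-w i)) x r)))
    ; ψ-e-nothing = λ i _ _ _ → proj₁ (inert-ww i)
    ; ψ-f-just = λ i x y r fx →
        ⊥-elim (just≢nothing (trans (sym fx) (onComponent (λ x → fW i x ≡ nothing) (proj₂ (inert-w i)) x r)))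
    ; ψ-f-nothing = λ i _ _ _ → proj₂ (inert-ww i)
    ; ψ-base = refl
    }
    where
    inert-w : ∀ i → Inert i w
    inert-w i = stuck⇒inert (stuck i)
    inert-ww : ∀ i → Inert i (w ++ w)
    inert-ww i = stuck⇒inert (stuck-++-self {i} {w} (stuck i))
    isolated-w : Isolated w
    isolated-w = inert⇒isolated inert-w
    isolated-ww : Isolated (w ++ w)
    isolated-ww = inert⇒isolated inert-ww
    onComponent : (P : Word → Set) → P w → ∀ x → Reach w x → P x
    onComponent P pw x r = subst P (sym (isolated-w x r)) pw
    wt-ww : wtW (w ++ w) ≡ wtW w
    wt-ww = begin
      wtW (w ++ w)     ≡⟨ wtW-++ w w ⟩
      wtW w +Λ wtW w   ≡⟨ cong₂ _+Λ_ wt≡0 wt≡0 ⟩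
      0Λ +Λ 0Λ         ≡⟨ +Λ-identityˡ 0Λ ⟩
      0Λ               ≡⟨ wt≡0 ⟨
      wtW w            ∎
      where open ≡-Reasoning
    just≢nothing : ∀ {v : Word} → just v ≢ nothing
    just≢nothing ()

  square-hypoplactic⇒wt≡0 : ∀ {w} → Hypoplactic w (w ++ w) → wtW w ≡ 0Λ
  square-hypoplactic⇒wt≡0 {w} H =
    +Λ-idem⇒0 (wtW w) (trans (sym (wtW-++ w w)) (trans (cong wtW (sym ψ-base)) (ψ-wt w here)))
    where open CompIso H

  infCase≡false⇒finite : ∀ i w → infCase i w ≡ false → All (λ x → ε i x ≢ +∞) w
  infCase≡false⇒finite i w finite =
    All.map isPlusInf≡false⇒≢+∞ (any≡false⇒All _ w (∨-conicalˡ _ _ finite))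

  total-finite : ∀ i w (g : Q → ℤ∞) → (∀ {x} → ε i x ≢ +∞ → g x ≡ fin (+ natPart (g x))) →
                 infCase i w ≡ false → total g i w ≡ fin (+ sum (map (natPart ∘ g) w))
  total-finite i w g g-finite finite =
    trans (if-false finite) (foldr-⊕-natPart g (All.map g-finite (infCase≡false⇒finite i w finite)))

  total≡fin⇒infCase≡false : ∀ i w (g : Q → ℤ∞) {n} → total g i w ≡ fin n → infCase i w ≡ false
  total≡fin⇒infCase≡false i w g eq with infCase i w
  ... | false = refl
  ... | true with () ← eq

  total-++-self⇒null : ∀ i w (g : Q → ℤ∞) → (∀ {x} → ε i x ≢ +∞ → g x ≡ fin (+ natPart (g x))) →
                       infCase i w ≡ false → total g i (w ++ w) ≡ total g i w → All (λ x → g x ≡ fin (+ 0)) w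
  total-++-self⇒null i w g g-finite finite eq = All.zipWith (uncurry fin-natPart-zero)
    (All.map g-finite (infCase≡false⇒finite i w finite) , sum≡0⇒All (natPart ∘ g) w (sum-++-self≡⇒0 _ w sums))
    where
    total-w = total-finite i w g g-finite finite
    total-ww = total-finite i (w ++ w) g g-finite (total≡fin⇒infCase≡false i (w ++ w) g (trans eq total-w))
    sums : sum (map (natPart ∘ g) (w ++ w)) ≡ sum (map (natPart ∘ g) w)
    sums = cong natPart (trans (sym total-ww) (trans eq total-w))

  module _ (sn : Seminormal C) where

    ε-finite : ∀ {i x} → ε i x ≢ +∞ → ε i x ≡ fin (+ natPart (ε i x))
    ε-finite {i} {x} finite = CountsIterates⇒finite (proj₁ (sn i x finite))

    φ-finite : ∀ {i x} → ε i x ≢ +∞ → φ i x ≡ fin (+ natPart (φ i x))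
    φ-finite {i} {x} finite = CountsIterates⇒finite (proj₂ (sn i x finite))

    e-defined : ∀ {i x} → ε i x ≢ +∞ → isPos (ε i x) ≡ true → e i x ≢ nothing
    e-defined {i} {x} finite = CountsIterates⇒defined (proj₁ (sn i x finite))

    f-defined : ∀ {i x} → ε i x ≢ +∞ → isPos (φ i x) ≡ true → f i x ≢ nothing
    f-defined {i} {x} finite = CountsIterates⇒defined (proj₂ (sn i x finite))

    square-hypoplactic⇒stuck : ∀ {w} → Hypoplactic w (w ++ w) → ∀ i → Stuck i w
    square-hypoplactic⇒stuck {w} H i with infCase i w in finite
    ... | true = inj₁ refl
    ... | false = inj₂ (All.zip
        ( total-++-self⇒null i w (ε i) ε-finite finite (trans (cong (εW i) (sym ψ-base)) (ψ-ε i w here))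
        , total-++-self⇒null i w (φ i) φ-finite finite (trans (cong (φW i) (sym ψ-base)) (ψ-φ i w here))))
      where open CompIso H

    inert⇒stuck : ∀ {i w} → Inert i w → Stuck i w
    inert⇒stuck {i} {w} (e-undefined , f-undefined) with infCase i w in finite
    ... | true = inj₁ refl
    ... | false = inj₂ (All.zipWith (λ {x} (finite-x , ε≤0 , φ≤0) →
          fin-natPart-zero (ε-finite finite-x) (natPart-nonpositive (ε i x) ε≤0)
        , fin-natPart-zero (φ-finite finite-x) (natPart-nonpositive (φ i x) φ≤0))
        (letters-finite , All.zip
          ( update-last≡nothing⇒All _ w (All.map e-defined letters-finite) e-undefined
          , update-first≡nothing⇒All _ w (All.map f-defined letters-finite) f-undefined)))
      where
      letters-finite = infCase≡false⇒finite i w finite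

theorem7p6 : (R : RootDatum) (C : QuasiCrystal R) → Seminormal C →
    (w : List (QuasiCrystal.Q C)) →
    WordOps.Hypoplactic C w (w ++ w)
      ⇔ (WordOps.Isolated C w × WordOps.wtW C w ≡ RootDatum.0Λ R)
theorem7p6 R C sn w = mk⇔
  (λ square → inert⇒isolated (λ i → stuck⇒inert (square-hypoplactic⇒stuck sn square i))
            , square-hypoplactic⇒wt≡0 square)
  (λ (isolated , wt≡0) → stuck⇒square-hypoplactic (λ i → inert⇒stuck sn (isolated⇒inert isolated i)) wt≡0)
  where open Doubling C
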